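{- Let $p\ge 2$ be an integer. For every $0\le i\le 2^p-1$, every integer $n\ge 0$, and every $0\le r\le p-1$, the weight sequences satisfy \[ w_i(pn+r)=w_{x_r(i)}(n)\,w_i(n). \]
   Context: For an integer $n\ge0$, $v_p(n)\in\{0,\dots,p-1\}$ denotes the sum of the base-$p$ digits of $n$ reduced modulo $p$. For $0\le i\le 2^p-1$ write its binary expansion $i=d^{(i)}_{p-1}2^{p-1}+\cdots+d^{(i)}_0$; the weight sequences are $w_i(n)=(-1)^{d^{(i)}_{p-1-v_p(n)}}$. For $0\le r<p$, the degree-$p$ xor-shift of $i$ by $r$ is $x_r(i)=e_{p-1}2^{p-1}+\cdots+e_0$, where, writing $d_k=d_k^{(i)}$, $e_k=d_k\oplus d_{k-r}$ if $k\ge r$ and $e_k=d_k\oplus d_{k+(p-r)}$ if $k<r$ ($\oplus$ = XOR on bits); i.e. the bitwise XOR of $i$ with the cyclic left rotation by $r$ of its $p$-bit representation. Note $0\le x_r(i)\le 2^p-1$. -}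

module Defs where

open import Data.Nat using (ℕ; zero; suc; _+_; _*_; _∸_; _^_; _<_; _<ᵇ_)
open import Data.Nat.DivMod using (_/_; _%_)
open import Data.Bool using (Bool; true; false; if_then_else_)
open import Data.Integer using (ℤ; +_; -_)

-- Sum of the base-(suc (suc q)) digits of n (i.e. base b = q+2 ≥ 2).
-- Fuel-based recursion; fuel n suffices since n / b < n for n > 0.
digitSumFuel : ℕ → ℕ → ℕ → ℕ
digitSumFuel q zero    n = 0
digitSumFuel q (suc f) n = n % suc (suc q) + digitSumFuel q f (n / suc (suc q))

-- base-p digit sum of n (p ≥ 2; for p < 2 the value is a dummy 0)
digitSum : ℕ → ℕ → ℕ
digitSum zero          n = 0
digitSum (suc zero)    n = 0
digitSum (suc (suc q)) n = digitSumFuel q n n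

v : ℕ → ℕ → ℕ
v zero          n = 0
v (suc zero)    n = 0
v (suc (suc q)) n = digitSum (suc (suc q)) n % suc (suc q)

bit : ℕ → ℕ → ℕ
bit i zero    = i % 2
bit i (suc k) = bit (i / 2) k

signOf : ℕ → ℤ
signOf zero    = + 1
signOf (suc _) = - (+ 1)

w : ℕ → ℕ → ℕ → ℤ
w p i n = signOf (bit i (p ∸ 1 ∸ v p n))

xorBit : ℕ → ℕ → ℕ
xorBit a b = (a + b) % 2

eBit : ℕ → ℕ → ℕ → ℕ → ℕ
eBit p r i k = if k <ᵇ r
               then xorBit (bit i k) (bit i (k + (p ∸ r)))
               else xorBit (bit i k) (bit i (k ∸ r))

xsum : ℕ → ℕ → ℕ → ℕ → ℕ
xsum p r i zero    = 0
xsum p r i (suc m) = xsum p r i m + eBit p r i m * 2 ^ m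

x : ℕ → ℕ → ℕ → ℕ
x p r i = xsum p r i p

{-# OPTIONS --safe #-}

-- Since the base-p digits of pn + r are r followed by those of n, v(pn + r) ≡ r + v(n)
-- (mod p).  So w_i(pn + r) reads the bit of i sitting cyclically r places below bit
-- a = p − 1 − v(n), the bit read by w_i(n).  Bit a of x_r(i) is by construction the XOR of
-- these two bits of i, and (−1)^(u ⊕ t) (−1)^u = (−1)^t.

module Submission where

open import Defs
open import Data.Nat using (ℕ; _≤_; _<_; _+_; _*_; _^_)
open import Data.Integer using (ℤ) renaming (_*_ to _*ℤ_)
open import Relation.Binary.PropositionalEquality using (_≡_)
open import Data.Nat.Base using (zero; suc; _∸_; _<ᵇ_; z≤n; s≤s; NonZero)
open import Data.Nat.Properties
open import Data.Nat.DivMod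
open import Data.Nat.Divisibility using (divides-refl)
open import Data.Bool using (true; false; T; if_then_else_)
open import Data.Sum using (inj₁; inj₂)
open import Function using (_∘_)
open import Data.Unit using (tt)
open import Relation.Binary.PropositionalEquality
  using (refl; sym; trans; cong; cong₂; subst; module ≡-Reasoning)

[m+kn]/n≡m/n+k : ∀ m k n .{{_ : NonZero n}} → (m + k * n) / n ≡ m / n + k
[m+kn]/n≡m/n+k m k n = trans (+-distrib-/-∣ʳ m (divides-refl k)) (cong (m / n +_) (m*n/n≡m k n))

[m+kn]/n≡k : ∀ {m} k n .{{_ : NonZero n}} → m < n → (m + k * n) / n ≡ k
[m+kn]/n≡k k n m<n = trans ([m+kn]/n≡m/n+k _ k n) (cong (_+ k) (m<n⇒m/n≡0 m<n))

[m+kn]%n≡m : ∀ {m} k n .{{_ : NonZero n}} → m < n → (m + k * n) % n ≡ m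
[m+kn]%n≡m {m} k n m<n = trans ([m+kn]%n≡m%n m k n) (m<n⇒m%n≡m m<n)

[m+n%d]%d≡[m+n]%d : ∀ m n d .{{_ : NonZero d}} → (m + n % d) % d ≡ (m + n) % d
[m+n%d]%d≡[m+n]%d m n d = begin
  (m + n % d) % d                 ≡⟨ [m+kn]%n≡m%n (m + n % d) (n / d) d ⟨
  (m + n % d + n / d * d) % d     ≡⟨ cong (_% d) (+-assoc m (n % d) (n / d * d)) ⟩
  (m + (n % d + n / d * d)) % d   ≡⟨ cong (λ k → (m + k) % d) (m≡m%n+[m/n]*n n d) ⟨
  (m + n) % d                     ∎
  where open ≡-Reasoning

bit<2 : ∀ i k → bit i k < 2
bit<2 i zero    = m%n<n i 2
bit<2 i (suc k) = bit<2 (i / 2) k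

bit-0 : ∀ {c} → c < 2 → bit c 0 ≡ c
bit-0 = m<n⇒m%n≡m

private
  m*2^[1+n]≡m*2^n*2 : ∀ m n → m * 2 ^ suc n ≡ m * 2 ^ n * 2
  m*2^[1+n]≡m*2^n*2 m n = trans (cong (m *_) (*-comm 2 (2 ^ n))) (sym (*-assoc m (2 ^ n) 2))

  m<2^[1+n]⇒m/2<2^n : ∀ {m} n → m < 2 ^ suc n → m / 2 < 2 ^ n
  m<2^[1+n]⇒m/2<2^n {m} n m< = m<n*o⇒m/o<n (subst (m <_) (*-comm 2 (2 ^ n)) m<)

  bit-suc-+ : ∀ y c m k → bit (y + c * 2 ^ suc m) (suc k) ≡ bit (y / 2 + c * 2 ^ m) k
  bit-suc-+ y c m k = cong (λ z → bit z k)
    (trans (cong (λ z → (y + z) / 2) (m*2^[1+n]≡m*2^n*2 c m)) ([m+kn]/n≡m/n+k y (c * 2 ^ m) 2))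

bit-+-low : ∀ {y} c m {k} → y < 2 ^ m → k < m → bit (y + c * 2 ^ m) k ≡ bit y k
bit-+-low {y} c (suc m) {zero} _ _ =
  trans (cong (λ z → (y + z) % 2) (m*2^[1+n]≡m*2^n*2 c m)) ([m+kn]%n≡m%n y (c * 2 ^ m) 2)
bit-+-low {y} c (suc m) {suc k} y< (s≤s k<m) =
  trans (bit-suc-+ y c m k) (bit-+-low c m (m<2^[1+n]⇒m/2<2^n m y<) k<m)

bit-+-high : ∀ {y} c m k → y < 2 ^ m → bit (y + c * 2 ^ m) (m + k) ≡ bit c k
bit-+-high {zero}  c zero k _          = cong (λ z → bit z k) (*-identityʳ c)
bit-+-high {suc _} c zero k (s≤s ())
bit-+-high {y} c (suc m) k y< = trans (bit-suc-+ y c m (m + k)) (bit-+-high c m k (m<2^[1+n]⇒m/2<2^n m y<))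

fromBits : (ℕ → ℕ) → ℕ → ℕ
fromBits f zero    = 0
fromBits f (suc m) = fromBits f m + f m * 2 ^ m

module _ {f : ℕ → ℕ} (f<2 : ∀ k → f k < 2) where

  fromBits-< : ∀ m → fromBits f m < 2 ^ m
  fromBits-< zero    = s≤s z≤n
  fromBits-< (suc m) = begin-strict
    fromBits f m + f m * 2 ^ m  <⟨ +-monoˡ-< (f m * 2 ^ m) (fromBits-< m) ⟩
    2 ^ m + f m * 2 ^ m         ≤⟨ +-monoʳ-≤ (2 ^ m) (*-monoˡ-≤ (2 ^ m) (m<1+n⇒m≤n (f<2 m))) ⟩
    2 ^ m + 1 * 2 ^ m           ∎
    where open ≤-Reasoning

  bit-fromBits : ∀ {m k} → k < m → bit (fromBits f m) k ≡ f k
  bit-fromBits {suc m} k<1+m with m<1+n⇒m<n∨m≡n k<1+m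
  ... | inj₁ k<m  = trans (bit-+-low (f m) m (fromBits-< m) k<m) (bit-fromBits k<m)
  ... | inj₂ refl = begin
    bit (fromBits f m + f m * 2 ^ m) m        ≡⟨ cong (bit _) (+-identityʳ m) ⟨
    bit (fromBits f m + f m * 2 ^ m) (m + 0)  ≡⟨ bit-+-high (f m) m 0 (fromBits-< m) ⟩
    bit (f m) 0                               ≡⟨ bit-0 (f<2 m) ⟩
    f m                                       ∎
    where open ≡-Reasoning

xsum≡fromBits : ∀ p r i m → xsum p r i m ≡ fromBits (eBit p r i) m
xsum≡fromBits p r i zero    = refl
xsum≡fromBits p r i (suc m) = cong (_+ eBit p r i m * 2 ^ m) (xsum≡fromBits p r i m)

xorBit<2 : ∀ a b → xorBit a b < 2
xorBit<2 a b = m%n<n (a + b) 2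

-- For k, r < p this is k − r modulo p: the bit of i that x_r(i) XORs into bit k.
rotateIndex : ℕ → ℕ → ℕ → ℕ
rotateIndex p r k = if k <ᵇ r then k + (p ∸ r) else k ∸ r

eBit≡xorBit-rotateIndex : ∀ p r i k → eBit p r i k ≡ xorBit (bit i k) (bit i (rotateIndex p r k))
eBit≡xorBit-rotateIndex p r i k with k <ᵇ r
... | true  = refl
... | false = refl

eBit<2 : ∀ p r i k → eBit p r i k < 2
eBit<2 p r i k = subst (_< 2) (sym (eBit≡xorBit-rotateIndex p r i k)) (xorBit<2 (bit i k) (bit i (rotateIndex p r k)))

bit-x : ∀ p r i {k} → k < p → bit (x p r i) k ≡ xorBit (bit i k) (bit i (rotateIndex p r k))
bit-x p r i {k} k<p = begin
  bit (xsum p r i p) k             ≡⟨ cong (λ z → bit z k) (xsum≡fromBits p r i p) ⟩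
  bit (fromBits (eBit p r i) p) k  ≡⟨ bit-fromBits (eBit<2 p r i) k<p ⟩
  eBit p r i k                     ≡⟨ eBit≡xorBit-rotateIndex p r i k ⟩
  xorBit (bit i k) (bit i (rotateIndex p r k)) ∎
  where open ≡-Reasoning

m+n≡o⇒o∸n≡m : ∀ {m n o} → m + n ≡ o → o ∸ n ≡ m
m+n≡o⇒o∸n≡m {m} {n} refl = m+n∸n≡m m n

rotateIndex-complement : ∀ {m r s} → r ≤ m → s ≤ m →
                         rotateIndex (suc m) r (m ∸ s) ≡ m ∸ (r + s) % suc m
rotateIndex-complement {m} {r} {s} r≤m s≤m with (m ∸ s) <ᵇ r in lt
... | false = begin
  a ∸ r                 ≡⟨ m+n≡o⇒o∸n≡m sum ⟨
  m ∸ (r + s)           ≡⟨ cong (m ∸_) (m<n⇒m%n≡m (s≤s r+s≤m)) ⟨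
  m ∸ (r + s) % suc m   ∎
  where
  open ≡-Reasoning
  a = m ∸ s
  r≤a : r ≤ a
  r≤a = ≮⇒≥ (λ a<r → subst T lt (<⇒<ᵇ a<r))
  a+s≡m : a + s ≡ m
  a+s≡m = m∸n+n≡m s≤m
  r+s≤m : r + s ≤ m
  r+s≤m = subst (r + s ≤_) a+s≡m (+-monoˡ-≤ s r≤a)
  sum : a ∸ r + (r + s) ≡ m
  sum = trans (sym (+-assoc (a ∸ r) r s)) (trans (cong (_+ s) (m∸n+n≡m r≤a)) a+s≡m)
... | true = begin
  a + (suc m ∸ r)       ≡⟨ m+n≡o⇒o∸n≡m sum ⟨
  m ∸ y                 ≡⟨ cong (m ∸_) ([m+kn]%n≡m 1 (suc m) y<1+m) ⟨
  m ∸ (y + 1 * suc m) % suc m ≡⟨ cong (λ z → m ∸ z % suc m) r+s≡y+1+m ⟨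
  m ∸ (r + s) % suc m   ∎
  where
  open ≡-Reasoning
  a = m ∸ s
  a<r : a < r
  a<r = <ᵇ⇒< a r (subst T (sym lt) tt)
  y = r ∸ suc a
  y<1+m : y < suc m
  y<1+m = s≤s (≤-trans (m∸n≤m r (suc a)) r≤m)
  r+s≡y+1+m : r + s ≡ y + 1 * suc m
  r+s≡y+1+m = begin
    r + s            ≡⟨ cong (_+ s) (m∸n+n≡m a<r) ⟨
    y + suc a + s    ≡⟨ +-assoc y (suc a) s ⟩
    y + suc (a + s)  ≡⟨ cong (λ z → y + suc z) (m∸n+n≡m s≤m) ⟩
    y + suc m        ≡⟨ cong (y +_) (*-identityˡ (suc m)) ⟨
    y + 1 * suc m    ∎
  sum : a + (suc m ∸ r) + y ≡ m
  sum = begin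
    a + (suc m ∸ r) + y          ≡⟨ +-assoc a (suc m ∸ r) y ⟩
    a + (suc m ∸ r + y)          ≡⟨ cong (a +_) (+-∸-assoc (suc m ∸ r) a<r) ⟨
    a + (suc m ∸ r + r ∸ suc a)  ≡⟨ cong (λ z → a + (z ∸ suc a)) (m∸n+n≡m (m≤n⇒m≤1+n r≤m)) ⟩
    a + (m ∸ a)                  ≡⟨ m+[n∸m]≡n (m∸n≤m m s) ⟩
    m                            ∎

digitSumFuel-0 : ∀ q f → digitSumFuel q f 0 ≡ 0
digitSumFuel-0 q zero    = refl
digitSumFuel-0 q (suc f) = digitSumFuel-0 q f

m≤1+n⇒m/d≤n : ∀ {m n} d .{{_ : NonZero d}} → 1 < d → m ≤ suc n → m / d ≤ n
m≤1+n⇒m/d≤n {zero}  d _   _     = subst (_≤ _) (sym (0/n≡0 d)) z≤n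
m≤1+n⇒m/d≤n {suc m} d 1<d m≤1+n = m<1+n⇒m≤n (<-≤-trans (m/n<m (suc m) d 1<d) m≤1+n)

digitSumFuel-irrelevant : ∀ q {f g n} → n ≤ f → n ≤ g → digitSumFuel q f n ≡ digitSumFuel q g n
digitSumFuel-irrelevant q {zero}  {g}     z≤n _   = sym (digitSumFuel-0 q g)
digitSumFuel-irrelevant q {suc f} {zero}  _   z≤n = digitSumFuel-0 q (suc f)
digitSumFuel-irrelevant q {suc f} {suc g} {n} n≤f n≤g =
  cong (n % suc (suc q) +_) (digitSumFuel-irrelevant q (m≤1+n⇒m/d≤n (suc (suc q)) (s≤s (s≤s z≤n)) n≤f)
                                                       (m≤1+n⇒m/d≤n (suc (suc q)) (s≤s (s≤s z≤n)) n≤g))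

digitSum-unfold : ∀ q n → let b = suc (suc q) in digitSum b n ≡ n % b + digitSum b (n / b)
digitSum-unfold q zero    = refl
digitSum-unfold q (suc n) =
  cong (suc n % suc (suc q) +_)
       (digitSumFuel-irrelevant q {n} {suc n / suc (suc q)} (m≤1+n⇒m/d≤n (suc (suc q)) (s≤s (s≤s z≤n)) ≤-refl) ≤-refl)

digitSum-*+ : ∀ q n {r} → let b = suc (suc q) in r < b → digitSum b (b * n + r) ≡ r + digitSum b n
digitSum-*+ q n {r} r<b = begin
  digitSum b (b * n + r)                                ≡⟨ digitSum-unfold q (b * n + r) ⟩
  (b * n + r) % b + digitSum b ((b * n + r) / b)        ≡⟨ cong₂ (λ u z → u % b + digitSum b (z / b)) bn+r≡r+nb bn+r≡r+nb ⟩
  (r + n * b) % b + digitSum b ((r + n * b) / b)        ≡⟨ cong₂ (λ u z → u + digitSum b z) ([m+kn]%n≡m n b r<b) ([m+kn]/n≡k n b r<b) ⟩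
  r + digitSum b n                                      ∎
  where
  open ≡-Reasoning
  b = suc (suc q)
  bn+r≡r+nb : b * n + r ≡ r + n * b
  bn+r≡r+nb = trans (+-comm (b * n) r) (cong (r +_) (*-comm b n))

v-*+ : ∀ q n {r} → let b = suc (suc q) in r < b → v b (b * n + r) ≡ (r + v b n) % b
v-*+ q n {r} r<b = trans (cong (_% suc (suc q)) (digitSum-*+ q n r<b))
                         (sym ([m+n%d]%d≡[m+n]%d r (digitSum (suc (suc q)) n) (suc (suc q))))

signOf-xorBit : ∀ {u t} → u < 2 → t < 2 → signOf (xorBit u t) *ℤ signOf u ≡ signOf t
signOf-xorBit {0} {0} _ _ = refl
signOf-xorBit {0} {1} _ _ = refl
signOf-xorBit {1} {0} _ _ = refl
signOf-xorBit {1} {1} _ _ = refl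
signOf-xorBit {suc (suc _)} (s≤s (s≤s ())) _
signOf-xorBit {_} {suc (suc _)} _ (s≤s (s≤s ()))

mainTheorem9 : (p : ℕ) → 2 ≤ p → (i : ℕ) → i < 2 ^ p → (n r : ℕ) → r < p →
    w p i (p * n + r) ≡ w p (x p r i) n *ℤ w p i n
mainTheorem9 (suc zero) (s≤s ())
mainTheorem9 (suc (suc q)) _ i _ n r r<p = begin
  signOf (bit i (m ∸ v p (p * n + r)))            ≡⟨ cong (λ t → signOf (bit i (m ∸ t))) (v-*+ q n r<p) ⟩
  signOf (bit i (m ∸ (r + s) % p))                ≡⟨ cong (signOf ∘ bit i) (rotateIndex-complement (m<1+n⇒m≤n r<p) s≤m) ⟨
  signOf (bit i c)                                ≡⟨ signOf-xorBit (bit<2 i a) (bit<2 i c) ⟨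
  signOf (xorBit (bit i a) (bit i c)) *ℤ signOf (bit i a) ≡⟨ cong (λ e → signOf e *ℤ signOf (bit i a)) (bit-x p r i a<p) ⟨
  signOf (bit (x p r i) a) *ℤ signOf (bit i a)    ∎
  where
  open ≡-Reasoning
  p = suc (suc q)
  m = suc q
  s = v p n
  s≤m : s ≤ m
  s≤m = m<1+n⇒m≤n (m%n<n (digitSum p n) p)
  a = m ∸ s
  a<p : a < p
  a<p = s≤s (m∸n≤m m s)
  c = rotateIndex p r a
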